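{- For all integers $s \ge 3$ and $t\ge 1$: (i) $|EN_{1,t}(321)| = 1$; (ii) $|EN_{2,t}(321)| = C_t$; (iii) $|EN_{s,t}(321)| = 0$. Here $C_n=\frac{1}{n+1}\binom{2n}{n}$ is the $n$th Catalan number.
   Context: For positive integers $s,t$, write each $x \in [st]=\{1,\dots,st\}$ uniquely as $x=(j-1)t+r$ with $1\le j\le s$ and $1\le r\le t$. The poset $EN_{s,t}$ is $[st]$ with the partial order $(j-1)t+r \preceq (j'-1)t+r'$ if and only if $j'\le j$ and $r\le r'$. A linear extension of a poset $([n],\preceq)$ is a permutation $\pi=\pi(1)\cdots\pi(n)$ of $[n]$ (one-line notation) such that whenever $a\preceq b$ and $a\ne b$, $a$ appears before $b$ in $\pi$. A permutation $\pi$ contains $\sigma$ if $\pi$ has a subsequence with the same relative order as $\sigma$, and avoids $\sigma$ otherwise. $P(\sigma_1,\dots,\sigma_k)$ denotes the set of linear extensions of the poset $P$ avoiding each $\sigma_i$. -}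

module Defs where

open import Data.Nat using (ℕ; zero; suc; _+_; _*_; _∸_; _≤_; _<_)
open import Data.Nat.DivMod using (_/_; _%_)
open import Data.Nat.Combinatorics using (_C_)
open import Data.List using (List; []; _∷_; map; upTo; length; lookup)
open import Data.List.Membership.Propositional using (_∈_)
open import Data.List.Relation.Unary.Unique.Propositional using (Unique)
open import Data.List.Relation.Binary.Permutation.Propositional using (_↭_)
open import Data.List.Relation.Binary.Sublist.Propositional using (_⊆_)
open import Data.Fin using (Fin)
open import Data.Fin.Properties using ()
open import Data.Product using (Σ; ∃; _×_; _,_)
open import Function.Bundles using (_⇔_)
open import Relation.Binary.PropositionalEquality using (_≡_; _≢_; subst)
open import Relation.Nullary using (¬_)

[_] : ℕ → List ℕ
[ n ] = map suc (upTo n)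

-- x = (j-1)t + r with 1 ≤ j ≤ s, 1 ≤ r ≤ t ; for t ≥ 1:
-- j = (x-1)/t + 1 ,  r = (x-1)%t + 1.  (Only used for t = suc t'.)
blk : (t' : ℕ) → ℕ → ℕ
blk t' x = (x ∸ 1) / suc t'

res : (t' : ℕ) → ℕ → ℕ
res t' x = (x ∸ 1) % suc t'

-- partial order of EN_{s,t} with t = suc t' (s only determines the ground set)
-- x ⪯ y  iff  j_y ≤ j_x and r_x ≤ r_y
_⟨_⟩⪯_ : ℕ → ℕ → ℕ → Set
x ⟨ t' ⟩⪯ y = (blk t' y ≤ blk t' x) × (res t' x ≤ res t' y)

IsPermOf : ℕ → List ℕ → Set
IsPermOf n π = π ↭ [ n ]

AppearsBefore : ℕ → ℕ → List ℕ → Set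
AppearsBefore a b π = (a ∷ b ∷ []) ⊆ π

IsLinExtEN : ℕ → ℕ → List ℕ → Set
IsLinExtEN s t' π =
  IsPermOf (s * suc t') π ×
  (∀ a b → a ∈ [ s * suc t' ] → b ∈ [ s * suc t' ] →
     a ⟨ t' ⟩⪯ b → a ≢ b → AppearsBefore a b π)

OrderIso : List ℕ → List ℕ → Set
OrderIso τ σ = Σ (length τ ≡ length σ) λ eq →
  ∀ (i j : Fin (length τ)) →
    (lookup τ i < lookup τ j) ⇔
    (lookup σ (subst Fin eq i) < lookup σ (subst Fin eq j))

Contains : List ℕ → List ℕ → Set
Contains π σ = ∃ λ τ → (τ ⊆ π) × OrderIso τ σ

Avoids : List ℕ → List ℕ → Set
Avoids π σ = ¬ Contains π σ

InEN321 : ℕ → ℕ → List ℕ → Set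
InEN321 s t' π = IsLinExtEN s t' π × Avoids π (3 ∷ 2 ∷ 1 ∷ [])

HasSize : (List ℕ → Set) → ℕ → Set
HasSize P k = ∃ λ (L : List (List ℕ)) →
  Unique L × (∀ π → (π ∈ L) ⇔ P π) × (length L ≡ k)

Catalan : ℕ → ℕ
Catalan n = ((2 * n) C n) / suc n

-- EN_{s,t} is a union of s blocks of t consecutive integers; inside a block ⪯ is
-- the usual order, and (j-1)t + r lies below every element of an earlier block
-- whose residue is at least r.  For s = 1 the identity is the only linear
-- extension.  For s ≥ 3 the least elements 2t + 1 ⪯ t + 1 ⪯ 1 of the first three
-- blocks form a chain, i.e. a forced 321.  For s = 2 a linear extension is a
-- shuffle of the increasing runs 1 … t and t+1 … 2t, hence 321-avoiding, and the
-- relations t + r ⪯ r, …, t say exactly that the word recording which run each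
-- entry comes from is a Dyck word; by the ballot formula there are
-- C(2t, t) − C(2t, t + 1) = C_t of them.

module Submission where

open import Defs
open import Relation.Binary.PropositionalEquality
  using (_≡_; _≢_; refl; sym; trans; cong; cong₂; subst; subst₂; setoid; module ≡-Reasoning)
open import Data.Nat using (ℕ; zero; suc; _+_; _*_; _∸_; _≤_; _<_; z≤n; s≤s; _≤ᵇ_; _≤?_; _≟_)
open import Data.Nat.Properties
open import Data.Bool using (Bool; true; false; T)
open import Data.List using (List; []; _∷_; map; _++_; length; applyUpTo; iterate; replicate; lookup)
open import Data.List.Properties using (∷-injectiveʳ; length-map; length-++; map-∘; map-id-local)
open import Data.List.Membership.Propositional using (_∈_)
open import Data.List.Membership.Propositional.Properties using (∈-++⁺ˡ; ∈-++⁺ʳ; ∈-++⁻; ∈-map⁺; ∈-map⁻)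
open import Data.List.Relation.Unary.Any using (here; there)
open import Data.List.Relation.Unary.All as All using ([])
open import Data.List.Relation.Unary.Unique.Propositional using (Unique; []; _∷_)
open import Data.List.Relation.Unary.Unique.Propositional.Properties as Unique using ()
open import Data.List.Relation.Binary.Sublist.Propositional using (_⊆_; []; _∷_; _∷ʳ_; ⊆-trans; minimum; from∈; to∈)
open import Data.List.Relation.Binary.Sublist.Propositional as Sublist using ()
open import Data.List.Relation.Binary.Permutation.Propositional as Perm using (_↭_; ↭-sym; ↭-trans; ↭⇒↭ₛ)
open import Data.List.Relation.Binary.Permutation.Propositional.Properties using (∈-resp-↭; shift; drop-∷; ↭-length)
open import Data.List.Relation.Binary.Sublist.Heterogeneous.Properties using (toPointwise)
open import Data.List.Relation.Binary.Pointwise using (Pointwise-≡⇒≡)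
open import Data.List.Relation.Binary.Permutation.Setoid.Properties (setoid ℕ) using (Unique-resp-↭)
open import Data.Product using (∃; _×_; _,_; proj₁; proj₂)
open import Data.Sum using (_⊎_; inj₁; inj₂)
open import Data.Empty using (⊥; ⊥-elim)
open import Relation.Nullary using (¬_; yes; no)
open import Data.Bool.Properties using (T-≡; ¬-not)
open import Data.Nat.Combinatorics using (_C_; nCk≡nC[n∸k]; nCn≡1; nC1≡n; nCk+nC[k+1]≡[n+1]C[k+1]; k>n⇒nCk≡0)
open import Data.Nat.DivMod using (_/_; _%_; m*n/n≡m; m<n⇒m/n≡0; m<n⇒m%n≡m; [m+kn]%n≡m%n; +-distrib-/-∣ʳ)
open import Data.Nat.Divisibility using (n∣m*n)
open import Data.Nat.Solver using (module +-*-Solver)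
open +-*-Solver using (solve; _:+_; _:*_; _:=_; con)
open import Data.Fin using (zero; suc)
open import Function.Bundles using (_⇔_; mk⇔; Equivalence)

range : ℕ → ℕ → List ℕ
range = iterate suc

∈-range⁻ : ∀ i f {x} → x ∈ range i f → i ≤ x × x < i + f
∈-range⁻ i (suc f) (here refl) = ≤-refl , m<m+n i (s≤s z≤n)
∈-range⁻ i (suc f) {x} (there p) with ∈-range⁻ (suc i) f p
... | i<x , x<i+1+f = <⇒≤ i<x , subst (x <_) (sym (+-suc i f)) x<i+1+f

∈-range⁺ : ∀ i f {x} → i ≤ x → x < i + f → x ∈ range i f
∈-range⁺ i zero i≤x x<i+0 = ⊥-elim (<⇒≱ (subst (_ <_) (+-identityʳ i) x<i+0) i≤x)
∈-range⁺ i (suc f) {x} i≤x x<i+1+f with i ≟ x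
... | yes refl = here refl
... | no i≢x = there (∈-range⁺ (suc i) f (≤∧≢⇒< i≤x i≢x) (subst (x <_) (+-suc i f) x<i+1+f))

range-++ : ∀ i a b → range i (a + b) ≡ range i a ++ range (i + a) b
range-++ i zero b = cong (λ j → range j b) (sym (+-identityʳ i))
range-++ i (suc a) b = cong (i ∷_) (trans (range-++ (suc i) a b) (cong (λ j → range (suc i) a ++ range j b) (sym (+-suc i a))))

map-suc-applyUpTo : ∀ i m (f : ℕ → ℕ) → (∀ x → f x ≡ i + x) → map suc (applyUpTo f m) ≡ range (suc i) m
map-suc-applyUpTo i zero f f≗i+ = refl
map-suc-applyUpTo i (suc m) f f≗i+ =
  cong₂ _∷_ (cong suc (trans (f≗i+ 0) (+-identityʳ i)))
            (map-suc-applyUpTo (suc i) m (λ x → f (suc x)) (λ x → trans (f≗i+ (suc x)) (+-suc i x)))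

[n]≡range : ∀ n → [ n ] ≡ range 1 n
[n]≡range n = map-suc-applyUpTo 0 n (λ x → x) (λ x → refl)

range-unique : ∀ i f → Unique (range i f)
range-unique i zero = []
range-unique i (suc f) =
  All.tabulate (λ x∈ i≡x → <-irrefl i≡x (proj₁ (∈-range⁻ (suc i) f x∈))) ∷ range-unique (suc i) f

pair⊆range : ∀ {i f x y} → x ∈ range i f → y ∈ range i f → x < y → (x ∷ y ∷ []) ⊆ range i f
pair⊆range {f = suc f} (here refl) (here refl) x<y = ⊥-elim (<-irrefl refl x<y)
pair⊆range {f = suc f} (here refl) (there y∈) x<y = refl ∷ from∈ y∈
pair⊆range {i} {suc f} (there x∈) (here refl) x<y = ⊥-elim (<-asym x<y (proj₁ (∈-range⁻ (suc i) f x∈)))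
pair⊆range {i} {suc f} (there x∈) (there y∈) x<y = i ∷ʳ pair⊆range x∈ y∈ x<y

range< : ∀ {i f k x} → i + f ≤ k → x ∈ range i f → x < k
range< {i} {f} i+f≤k x∈ = <-≤-trans (proj₂ (∈-range⁻ i f x∈)) i+f≤k

[n]-unique : ∀ n → Unique [ n ]
[n]-unique n = subst Unique (sym ([n]≡range n)) (range-unique 1 n)

⊆∧↭⇒≡ : ∀ {xs π : List ℕ} → xs ⊆ π → π ↭ xs → π ≡ xs
⊆∧↭⇒≡ xs⊆π π↭xs = sym (Pointwise-≡⇒≡ (toPointwise (sym (↭-length π↭xs)) xs⊆π))

before-tail : ∀ {u v h : ℕ} {π} → AppearsBefore u v (h ∷ π) → u ≢ h → AppearsBefore u v π
before-tail (_ ∷ʳ u<v) u≢h = u<v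
before-tail (refl ∷ _) u≢h = ⊥-elim (u≢h refl)

glue : ∀ {x y : ℕ} {ys π} → Unique π → AppearsBefore x y π → (y ∷ ys) ⊆ π → (x ∷ y ∷ ys) ⊆ π
glue (_ ∷ π!) (h ∷ʳ x<y) (.h ∷ʳ y∷ys⊆) = h ∷ʳ glue π! x<y y∷ys⊆
glue (h∉π ∷ _) (_ ∷ʳ x<y) (refl ∷ _) = ⊥-elim (All.lookup h∉π (Sublist.lookup x<y (there (here refl))) refl)
glue _ (refl ∷ y⊆) (_ ∷ʳ y∷ys⊆) = refl ∷ y∷ys⊆
glue (h∉π ∷ _) (refl ∷ y⊆) (refl ∷ _) = ⊥-elim (All.lookup h∉π (to∈ y⊆) refl)

⊆-head : ∀ {x y : ℕ} {ys π} → Unique (x ∷ π) → x ∈ y ∷ ys → (y ∷ ys) ⊆ x ∷ π → y ≡ x × ys ⊆ π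
⊆-head _ _ (refl ∷ ys⊆π) = refl , ys⊆π
⊆-head (x∉π ∷ _) x∈ (_ ∷ʳ y∷ys⊆π) = ⊥-elim (All.lookup x∉π (Sublist.lookup y∷ys⊆π x∈) refl)

⊆-tail : ∀ {h : ℕ} {xs π} → ¬ h ∈ xs → xs ⊆ h ∷ π → xs ⊆ π
⊆-tail h∉xs (_ ∷ʳ xs⊆π) = xs⊆π
⊆-tail h∉xs (refl ∷ _) = ⊥-elim (h∉xs (here refl))

range⊆ : ∀ i f {π} → Unique π → (∀ {x} → x ∈ range i f → x ∈ π) →
  (∀ {x} → x ∈ range i f → suc x ∈ range i f → AppearsBefore x (suc x) π) → range i f ⊆ π
range⊆ i zero π! ∈π before = minimum _
range⊆ i (suc zero) π! ∈π before = from∈ (∈π (here refl))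
range⊆ i (suc (suc f)) π! ∈π before =
  glue π! (before (here refl) (there (here refl)))
       (range⊆ (suc i) (suc f) π! (λ x∈ → ∈π (there x∈)) (λ x∈ sx∈ → before (there x∈) (there sx∈)))

-- Shuffles of two increasing runs

shuffle : ℕ → ℕ → List Bool → List ℕ
shuffle i k [] = []
shuffle i k (true ∷ w) = k ∷ shuffle i (suc k) w
shuffle i k (false ∷ w) = i ∷ shuffle (suc i) k w

falses trues : List Bool → ℕ
falses [] = 0
falses (true ∷ w) = falses w
falses (false ∷ w) = suc (falses w)
trues [] = 0
trues (true ∷ w) = suc (trues w)
trues (false ∷ w) = trues w

shuffle-↭ : ∀ i k w → shuffle i k w ↭ range i (falses w) ++ range k (trues w)
shuffle-↭ i k [] = Perm.refl
shuffle-↭ i k (true ∷ w) =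
  ↭-trans (Perm.prep k (shuffle-↭ i (suc k) w)) (↭-sym (shift k (range i (falses w)) (range (suc k) (trues w))))
shuffle-↭ i k (false ∷ w) = Perm.prep i (shuffle-↭ (suc i) k w)

range⊆shuffleˡ : ∀ i k w → range i (falses w) ⊆ shuffle i k w
range⊆shuffleˡ i k [] = []
range⊆shuffleˡ i k (true ∷ w) = k ∷ʳ range⊆shuffleˡ i (suc k) w
range⊆shuffleˡ i k (false ∷ w) = refl ∷ range⊆shuffleˡ (suc i) k w

range⊆shuffleʳ : ∀ i k w → range k (trues w) ⊆ shuffle i k w
range⊆shuffleʳ i k [] = []
range⊆shuffleʳ i k (true ∷ w) = refl ∷ range⊆shuffleʳ i (suc k) w
range⊆shuffleʳ i k (false ∷ w) = i ∷ʳ range⊆shuffleʳ (suc i) k w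

shuffle-falses : ∀ i k f → shuffle i k (replicate f false) ≡ range i f
shuffle-falses i k zero = refl
shuffle-falses i k (suc f) = cong (i ∷_) (shuffle-falses (suc i) k f)

∈-shuffle⁻ : ∀ i k w {x} → x ∈ shuffle i k w → i ≤ x ⊎ k ≤ x
∈-shuffle⁻ i k w x∈ with ∈-++⁻ (range i (falses w)) (∈-resp-↭ (shuffle-↭ i k w) x∈)
... | inj₁ x∈ˡ = inj₁ (proj₁ (∈-range⁻ i _ x∈ˡ))
... | inj₂ x∈ʳ = inj₂ (proj₁ (∈-range⁻ k _ x∈ʳ))

-- Both runs are increasing, so a descent takes its top from one run and its
-- bottom from the other; the top is therefore at least where each run starts.
descent-top : ∀ i k w {y z} → (y ∷ z ∷ []) ⊆ shuffle i k w → z < y → i ≤ y × k ≤ y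
descent-top i k (true ∷ w) (_ ∷ʳ yz⊆) z<y with descent-top i (suc k) w yz⊆ z<y
... | i≤y , k<y = i≤y , <⇒≤ k<y
descent-top i k (true ∷ w) (refl ∷ z⊆) z<k with ∈-shuffle⁻ i (suc k) w (to∈ z⊆)
... | inj₁ i≤z = <⇒≤ (≤-<-trans i≤z z<k) , ≤-refl
... | inj₂ k<z = ⊥-elim (<-asym z<k k<z)
descent-top i k (false ∷ w) (_ ∷ʳ yz⊆) z<y with descent-top (suc i) k w yz⊆ z<y
... | i<y , k≤y = <⇒≤ i<y , k≤y
descent-top i k (false ∷ w) (refl ∷ z⊆) z<i with ∈-shuffle⁻ (suc i) k w (to∈ z⊆)
... | inj₁ i<z = ⊥-elim (<-asym z<i i<z)
... | inj₂ k≤z = ≤-refl , <⇒≤ (≤-<-trans k≤z z<i)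

321-pattern⁻ : ∀ τ → OrderIso τ (3 ∷ 2 ∷ 1 ∷ []) →
  ∃ λ x → ∃ λ y → ∃ λ z → τ ≡ x ∷ y ∷ z ∷ [] × y < x × z < y
321-pattern⁻ (x ∷ y ∷ z ∷ []) (refl , iso) = x , y , z , refl ,
  Equivalence.from (iso (suc zero) zero) (s≤s (s≤s (s≤s z≤n))) ,
  Equivalence.from (iso (suc (suc zero)) (suc zero)) (s≤s (s≤s z≤n))

321-pattern⁺ : ∀ {x y z} → y < x → z < y → OrderIso (x ∷ y ∷ z ∷ []) (3 ∷ 2 ∷ 1 ∷ [])
321-pattern⁺ {x} {y} {z} y<x z<y = refl , iso
  where
  z<x = <-trans z<y y<x
  holds : ∀ {P Q : Set} → P → Q → P ⇔ Q
  holds p q = mk⇔ (λ _ → q) (λ _ → p)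
  fails : ∀ {P Q : Set} → ¬ P → ¬ Q → P ⇔ Q
  fails ¬p ¬q = mk⇔ (λ p → ⊥-elim (¬p p)) (λ q → ⊥-elim (¬q q))
  iso : ∀ i j → (lookup (x ∷ y ∷ z ∷ []) i < lookup (x ∷ y ∷ z ∷ []) j) ⇔
                (lookup (3 ∷ 2 ∷ 1 ∷ []) i < lookup (3 ∷ 2 ∷ 1 ∷ []) j)
  iso zero zero = fails (<-irrefl refl) (<-irrefl refl)
  iso zero (suc zero) = fails (<-asym y<x) (λ { (s≤s (s≤s ())) })
  iso zero (suc (suc zero)) = fails (<-asym z<x) (λ { (s≤s ()) })
  iso (suc zero) zero = holds y<x (s≤s (s≤s (s≤s z≤n)))
  iso (suc zero) (suc zero) = fails (<-irrefl refl) (<-irrefl refl)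
  iso (suc zero) (suc (suc zero)) = fails (<-asym z<y) (λ { (s≤s ()) })
  iso (suc (suc zero)) zero = holds z<x (s≤s (s≤s z≤n))
  iso (suc (suc zero)) (suc zero) = holds z<y (s≤s (s≤s z≤n))
  iso (suc (suc zero)) (suc (suc zero)) = fails (<-irrefl refl) (<-irrefl refl)

shuffle-avoids-321 : ∀ i k w → Avoids (shuffle i k w) (3 ∷ 2 ∷ 1 ∷ [])
shuffle-avoids-321 i k w (τ , τ⊆ , τ≅321) with 321-pattern⁻ τ τ≅321
... | x , y , z , refl , y<x , z<y = no-321 i k w τ⊆ y<x
  where
  no-321 : ∀ i k w {x} → (x ∷ y ∷ z ∷ []) ⊆ shuffle i k w → y < x → ⊥
  no-321 i k (true ∷ w) (_ ∷ʳ xyz⊆) y<x = no-321 i (suc k) w xyz⊆ y<x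
  no-321 i k (true ∷ w) (refl ∷ yz⊆) y<k = <⇒≱ y<k (<⇒≤ (proj₂ (descent-top i (suc k) w yz⊆ z<y)))
  no-321 i k (false ∷ w) (_ ∷ʳ xyz⊆) y<x = no-321 (suc i) k w xyz⊆ y<x
  no-321 i k (false ∷ w) (refl ∷ yz⊆) y<i = <⇒≱ y<i (<⇒≤ (proj₁ (descent-top (suc i) k w yz⊆ z<y)))

-- Ballot words

guard : ∀ {A : Set} → Bool → List A → List A
guard true xs = xs
guard false xs = []

∈-guard⁻ : ∀ {A : Set} {c} {xs : List A} {x} → x ∈ guard c xs → T c × x ∈ xs
∈-guard⁻ {c = true} x∈ = _ , x∈

∈-guard⁺ : ∀ {A : Set} {c} {xs : List A} {x} → T c → x ∈ xs → x ∈ guard c xs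
∈-guard⁺ {c = true} _ x∈ = x∈

guard-unique : ∀ {A : Set} c {xs : List A} → Unique xs → Unique (guard c xs)
guard-unique true xs! = xs!
guard-unique false xs! = []

-- Words with a trues and b falses in which every suffix has at most as many
-- trues as falses; ballot n n consists of the Dyck words of semilength n.
ballot : ℕ → ℕ → List (List Bool)
ballot zero zero = [] ∷ []
ballot zero (suc b) = map (false ∷_) (ballot zero b)
ballot (suc a) zero = []
ballot (suc a) (suc b) =
  map (true ∷_) (ballot a (suc b)) ++ guard (suc a ≤ᵇ b) (map (false ∷_) (ballot (suc a) b))

∈-ballot⁻ : ∀ a b {w} → w ∈ ballot (suc a) (suc b) →
  (∃ λ w' → w' ∈ ballot a (suc b) × w ≡ true ∷ w') ⊎
  (suc a ≤ b × ∃ λ w' → w' ∈ ballot (suc a) b × w ≡ false ∷ w')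
∈-ballot⁻ a b w∈ with ∈-++⁻ (map (true ∷_) (ballot a (suc b))) w∈
... | inj₁ w∈ᵗ = inj₁ (∈-map⁻ (true ∷_) w∈ᵗ)
... | inj₂ w∈ᶠ with ∈-guard⁻ {c = suc a ≤ᵇ b} w∈ᶠ
... | a<b , w∈ᶠ′ = inj₂ (≤ᵇ⇒≤ (suc a) b a<b , ∈-map⁻ (false ∷_) w∈ᶠ′)

∈-ballot-true⁺ : ∀ a b {w} → suc a ≤ b → w ∈ ballot a b → (true ∷ w) ∈ ballot (suc a) b
∈-ballot-true⁺ a (suc b) _ w∈ = ∈-++⁺ˡ (∈-map⁺ (true ∷_) w∈)

∈-ballot-false⁺ : ∀ a b {w} → a ≤ b → w ∈ ballot a b → (false ∷ w) ∈ ballot a (suc b)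
∈-ballot-false⁺ zero b _ w∈ = ∈-map⁺ (false ∷_) w∈
∈-ballot-false⁺ (suc a) b a≤b w∈ =
  ∈-++⁺ʳ (map (true ∷_) (ballot a (suc b))) (∈-guard⁺ (≤⇒≤ᵇ a≤b) (∈-map⁺ (false ∷_) w∈))

ballot-counts : ∀ a b {w} → w ∈ ballot a b → falses w ≡ b × trues w ≡ a
ballot-counts zero zero (here refl) = refl , refl
ballot-counts zero (suc b) w∈ with ∈-map⁻ (false ∷_) w∈
... | w' , w'∈ , refl = cong suc (proj₁ (ballot-counts zero b w'∈)) , proj₂ (ballot-counts zero b w'∈)
ballot-counts (suc a) (suc b) w∈ with ∈-ballot⁻ a b w∈
... | inj₁ (w' , w'∈ , refl) = proj₁ (ballot-counts a (suc b) w'∈) , cong suc (proj₂ (ballot-counts a (suc b) w'∈))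
... | inj₂ (_ , w' , w'∈ , refl) = cong suc (proj₁ (ballot-counts (suc a) b w'∈)) , proj₂ (ballot-counts (suc a) b w'∈)

module _ (a b i k : ℕ) {w : List Bool} (w∈ : w ∈ ballot a b) where

  ballot-shuffle-↭ : shuffle i k w ↭ range i b ++ range k a
  ballot-shuffle-↭ = subst₂ (λ f t → shuffle i k w ↭ range i f ++ range k t)
    (proj₁ (ballot-counts a b w∈)) (proj₂ (ballot-counts a b w∈)) (shuffle-↭ i k w)

  ballot-range⊆shuffleˡ : range i b ⊆ shuffle i k w
  ballot-range⊆shuffleˡ = subst (λ f → range i f ⊆ shuffle i k w) (proj₁ (ballot-counts a b w∈)) (range⊆shuffleˡ i k w)

  ballot-range⊆shuffleʳ : range k a ⊆ shuffle i k w
  ballot-range⊆shuffleʳ = subst (λ t → range k t ⊆ shuffle i k w) (proj₂ (ballot-counts a b w∈)) (range⊆shuffleʳ i k w)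

ballot-unique : ∀ a b → Unique (ballot a b)
ballot-unique zero zero = [] ∷ []
ballot-unique zero (suc b) = Unique.map⁺ ∷-injectiveʳ (ballot-unique zero b)
ballot-unique (suc a) zero = []
ballot-unique (suc a) (suc b) =
  Unique.++⁺ (Unique.map⁺ ∷-injectiveʳ (ballot-unique a (suc b)))
             (guard-unique (suc a ≤ᵇ b) (Unique.map⁺ ∷-injectiveʳ (ballot-unique (suc a) b)))
             disjoint
  where
  disjoint : ∀ {v} → ¬ (v ∈ map (true ∷_) (ballot a (suc b)) × v ∈ guard (suc a ≤ᵇ b) (map (false ∷_) (ballot (suc a) b)))
  disjoint (v∈ᵗ , v∈ᶠ) with ∈-map⁻ (true ∷_) v∈ᵗ | ∈-map⁻ (false ∷_) (proj₂ (∈-guard⁻ {c = suc a ≤ᵇ b} v∈ᶠ))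
  ... | _ , _ , refl | _ , _ , ()

-- k + a ≡ N + (i + b) says that the last upper element is N above the last lower
-- one, which is preserved when either run loses its first element.
shuffle-cross : ∀ N a b i k {w} → w ∈ ballot a b → k + a ≡ N + (i + b) →
  ∀ {y x} → y ∈ range k a → x ∈ range i b → y ≤ N + x → AppearsBefore y x (shuffle i k w)
shuffle-cross N (suc a) (suc b) i k w∈ k+a≡ y∈ x∈ y≤ with ∈-ballot⁻ a b w∈
shuffle-cross N (suc a) (suc b) i k w∈ k+a≡ (here refl) x∈ y≤ | inj₁ (w' , w'∈ , refl) =
  refl ∷ from∈ (Sublist.lookup (ballot-range⊆shuffleˡ a (suc b) i (suc k) w'∈) x∈)
shuffle-cross N (suc a) (suc b) i k w∈ k+a≡ (there y∈) x∈ y≤ | inj₁ (w' , w'∈ , refl) =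
  k ∷ʳ shuffle-cross N a (suc b) i (suc k) w'∈ (trans (sym (+-suc k a)) k+a≡) y∈ x∈ y≤
shuffle-cross N (suc a) (suc b) i k w∈ k+a≡ {y} y∈ (here refl) y≤ | inj₂ (a<b , w' , w'∈ , refl) =
  ⊥-elim (<-irrefl refl (begin-strict
    N + (i + suc b) ≡⟨ sym k+a≡ ⟩
    k + suc a       ≤⟨ +-monoˡ-≤ (suc a) (≤-trans (proj₁ (∈-range⁻ k (suc a) y∈)) y≤) ⟩
    N + i + suc a   ≤⟨ +-monoʳ-≤ (N + i) a<b ⟩
    N + i + b       <⟨ +-monoʳ-< (N + i) (n<1+n b) ⟩
    N + i + suc b   ≡⟨ +-assoc N i (suc b) ⟩
    N + (i + suc b) ∎))
  where open ≤-Reasoning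
shuffle-cross N (suc a) (suc b) i k w∈ k+a≡ y∈ (there x∈) y≤ | inj₂ (a<b , w' , w'∈ , refl) =
  i ∷ʳ shuffle-cross N (suc a) b (suc i) k w'∈ (trans k+a≡ (cong (N +_) (+-suc i b))) y∈ x∈ y≤

-- The first entry of π is the least remaining element of one of the two
-- blocks.  It can come from the lower block only while a ≤ b: otherwise the
-- cross condition forces k before i.
shuffle-complete : ∀ N a b i k {π} → a ≤ b → i + b ≤ k → k + a ≡ N + (i + b) → Unique π →
  π ↭ range i b ++ range k a → range i b ⊆ π → range k a ⊆ π →
  (∀ {y x} → y ∈ range k a → x ∈ range i b → y ≤ N + x → AppearsBefore y x π) →
  ∃ λ w → w ∈ ballot a b × π ≡ shuffle i k w
shuffle-complete N zero zero i k {[]} _ _ _ _ _ _ _ _ = [] , here refl , refl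
shuffle-complete N a (suc b) i k {[]} _ _ _ _ π↭ _ _ _ with ∈-resp-↭ (↭-sym π↭) (here refl)
... | ()
shuffle-complete N a b i k {x ∷ π} a≤b i+b≤k k+a≡ x∷π! π↭ lower⊆ upper⊆ cross
  with ∈-++⁻ (range i b) (∈-resp-↭ π↭ (here refl))
shuffle-complete N a (suc b) i k {x ∷ π} a≤b i+b≤k k+a≡ x∷π!@(_ ∷ π!) π↭ lower⊆ upper⊆ cross | inj₁ x∈lower
  with ⊆-head x∷π! x∈lower lower⊆
... | refl , lower⊆π with a ≤? b
...   | no a≰b = ⊥-elim (>⇒≢ (range< i+b≤k (here refl)) (proj₁ (⊆-head x∷π! (there (here refl)) k-before-i)))
  where
  b<a : b < a
  b<a = ≰⇒> a≰b
  k∈upper : k ∈ range k a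
  k∈upper = ∈-range⁺ k a ≤-refl (m<m+n k (≤-<-trans z≤n b<a))
  k-before-i : AppearsBefore k i (i ∷ π)
  k-before-i = cross k∈upper (here refl) (+-cancelʳ-≤ a k (N + i) (begin
    k + a           ≡⟨ k+a≡ ⟩
    N + (i + suc b) ≡⟨ sym (+-assoc N i (suc b)) ⟩
    N + i + suc b   ≤⟨ +-monoʳ-≤ (N + i) b<a ⟩
    N + i + a       ∎))
    where open ≤-Reasoning
...   | yes a≤b′
  with shuffle-complete N a b (suc i) k a≤b′ (subst (_≤ k) (+-suc i b) i+b≤k)
         (trans k+a≡ (cong (N +_) (+-suc i b))) π! (drop-∷ π↭) lower⊆π
         (⊆-tail (λ i∈ → <⇒≱ (range< i+b≤k (here refl)) (proj₁ (∈-range⁻ k a i∈))) upper⊆)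
         (λ y∈ x∈ y≤ → before-tail (cross y∈ (there x∈) y≤)
                                   (>⇒≢ (<-≤-trans (range< i+b≤k (here refl)) (proj₁ (∈-range⁻ k a y∈)))))
...     | w , w∈ , π≡ = false ∷ w , ∈-ballot-false⁺ a b a≤b′ w∈ , cong (i ∷_) π≡
shuffle-complete N (suc a) b i k {x ∷ π} a≤b i+b≤k k+a≡ x∷π!@(_ ∷ π!) π↭ lower⊆ upper⊆ cross | inj₂ x∈upper
  with ⊆-head x∷π! x∈upper upper⊆
... | refl , upper⊆π
  with shuffle-complete N a b i (suc k) (<⇒≤ a≤b) (m≤n⇒m≤1+n i+b≤k) (trans (sym (+-suc k a)) k+a≡)
         π! (drop-∷ (↭-trans π↭ (shift k (range i b) (range (suc k) a))))
         (⊆-tail (λ k∈ → <-irrefl refl (range< i+b≤k k∈)) lower⊆) upper⊆π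
         (λ y∈ x∈ y≤ → before-tail (cross (there y∈) x∈ y≤) (>⇒≢ (proj₁ (∈-range⁻ (suc k) a y∈))))
...     | w , w∈ , π≡ = true ∷ w , ∈-ballot-true⁺ a b a≤b w∈ , cong (k ∷_) π≡

map-≤ᵇ-shuffle : ∀ K i k w → i + falses w ≤ K → K ≤ k → map (K ≤ᵇ_) (shuffle i k w) ≡ w
map-≤ᵇ-shuffle K i k [] _ _ = refl
map-≤ᵇ-shuffle K i k (true ∷ w) i+f≤K K≤k =
  cong₂ _∷_ (Equivalence.to T-≡ (≤⇒≤ᵇ K≤k)) (map-≤ᵇ-shuffle K i (suc k) w i+f≤K (m≤n⇒m≤1+n K≤k))
map-≤ᵇ-shuffle K i k (false ∷ w) i+1+f≤K K≤k =
  cong₂ _∷_ (¬-not (λ K≤i → <⇒≱ i<K (≤ᵇ⇒≤ K i (Equivalence.from T-≡ K≤i))))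
            (map-≤ᵇ-shuffle K (suc i) k w (subst (_≤ K) (+-suc i (falses w)) i+1+f≤K) K≤k)
  where
  i<K : i < K
  i<K = <-≤-trans (m<m+n i (s≤s z≤n)) i+1+f≤K

shuffle-ballot-unique : ∀ a b i k → i + b ≤ k → Unique (map (shuffle i k) (ballot a b))
shuffle-ballot-unique a b i k i+b≤k =
  Unique.map⁻ {f = map (k ≤ᵇ_)} (subst Unique (sym decode-shuffle) (ballot-unique a b))
  where
  decode-shuffle : map (map (k ≤ᵇ_)) (map (shuffle i k) (ballot a b)) ≡ ballot a b
  decode-shuffle = trans (sym (map-∘ (ballot a b))) (map-id-local (All.tabulate λ {w} w∈ →
    map-≤ᵇ-shuffle k i k w (subst (λ f → i + f ≤ k) (sym (proj₁ (ballot-counts a b w∈))) i+b≤k) ≤-refl))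

-- Counting ballot words

length-ballot-zero : ∀ b → length (ballot zero b) ≡ 1
length-ballot-zero zero = refl
length-ballot-zero (suc b) = trans (length-map (false ∷_) (ballot zero b)) (length-ballot-zero b)

length-ballot-suc : ∀ a b → length (ballot (suc a) (suc b)) ≡
  length (ballot a (suc b)) + length (guard (suc a ≤ᵇ b) (map (false ∷_) (ballot (suc a) b)))
length-ballot-suc a b =
  trans (length-++ (map (true ∷_) (ballot a (suc b)))) (cong₂ _+_ (length-map (true ∷_) (ballot a (suc b))) refl)

length-guard-true : ∀ {A : Set} {c} (xs : List A) → T c → length (guard c xs) ≡ length xs
length-guard-true {c = true} xs _ = refl

length-guard-false : ∀ {A : Set} {c} (xs : List A) → ¬ T c → length (guard c xs) ≡ 0
length-guard-false {c = true} xs ¬t = ⊥-elim (¬t _)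
length-guard-false {c = false} xs ¬t = refl

pascal : ∀ m k → suc m C suc k ≡ m C k + m C suc k
pascal m k = sym (nCk+nC[k+1]≡[n+1]C[k+1] m k)

-- The ballot number C(a+b, b) − C(a+b, b+1), with the subtraction moved to the left.
length-ballot : ∀ a b → a ≤ b → length (ballot a b) + (a + b) C suc b ≡ (a + b) C b
length-ballot zero b _ = begin
  length (ballot zero b) + b C suc b ≡⟨ cong₂ _+_ (length-ballot-zero b) (k>n⇒nCk≡0 (n<1+n b)) ⟩
  1                                   ≡⟨ sym (nCn≡1 b) ⟩
  b C b                               ∎
  where open ≡-Reasoning
length-ballot (suc a) (suc b) a≤b with suc a ≤? b
... | yes a<b = begin
    length (ballot (suc a) (suc b)) + suc m C suc (suc b)
      ≡⟨ cong₂ _+_ (trans (length-ballot-suc a b) (cong (L↑ +_) L↓≡)) (pascal m (suc b)) ⟩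
    (L↑ + L↓) + (m C suc b + m C suc (suc b))
      ≡⟨ solve 4 (λ p q r s → (p :+ q) :+ (r :+ s) := (p :+ s) :+ (q :+ r)) refl L↑ L↓ (m C suc b) (m C suc (suc b)) ⟩
    (L↑ + m C suc (suc b)) + (L↓ + m C suc b)
      ≡⟨ cong₂ _+_ (length-ballot a (suc b) (m≤n⇒m≤1+n (<⇒≤ a<b))) IH↓ ⟩
    m C suc b + m C b ≡⟨ +-comm (m C suc b) (m C b) ⟩
    m C b + m C suc b ≡⟨ sym (pascal m b) ⟩
    suc m C suc b     ∎
  where
  open ≡-Reasoning
  m = a + suc b
  L↑ = length (ballot a (suc b))
  L↓ = length (ballot (suc a) b)
  L↓≡ : length (guard (suc a ≤ᵇ b) (map (false ∷_) (ballot (suc a) b))) ≡ L↓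
  L↓≡ = trans (length-guard-true _ (≤⇒≤ᵇ a<b)) (length-map (false ∷_) (ballot (suc a) b))
  IH↓ : L↓ + m C suc b ≡ m C b
  IH↓ = subst (λ q → L↓ + q C suc b ≡ q C b) (sym (+-suc a b)) (length-ballot (suc a) b a<b)
... | no a≮b with ≤-antisym (≤-pred a≤b) (≮⇒≥ a≮b)
... | refl = begin
    length (ballot (suc a) (suc a)) + suc m C suc (suc a)
      ≡⟨ cong₂ _+_ (trans (length-ballot-suc a a) (cong (L↑ +_) L↓≡0)) (pascal m (suc a)) ⟩
    (L↑ + 0) + (m C suc a + m C suc (suc a))
      ≡⟨ solve 3 (λ p r s → (p :+ con 0) :+ (r :+ s) := (p :+ s) :+ r) refl L↑ (m C suc a) (m C suc (suc a)) ⟩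
    (L↑ + m C suc (suc a)) + m C suc a
      ≡⟨ cong (_+ m C suc a) (length-ballot a (suc a) (n≤1+n a)) ⟩
    m C suc a + m C suc a ≡⟨ cong (_+ m C suc a) symmetric ⟩
    m C a + m C suc a     ≡⟨ sym (pascal m a) ⟩
    suc m C suc a         ∎
  where
  open ≡-Reasoning
  m = a + suc a
  L↑ = length (ballot a (suc a))
  L↓≡0 : length (guard (suc a ≤ᵇ a) (map (false ∷_) (ballot (suc a) a))) ≡ 0
  L↓≡0 = length-guard-false _ (λ t → a≮b (≤ᵇ⇒≤ (suc a) a t))
  symmetric : m C suc a ≡ m C a
  symmetric = trans (nCk≡nC[n∸k] (m≤n+m (suc a) a)) (cong (m C_) (m+n∸n≡m a (suc a)))

absorption : ∀ m k → suc k * (m C suc k) + k * (m C k) ≡ m * (m C k)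
absorption zero zero = refl
absorption zero (suc k) = begin
    suc (suc k) * (0 C suc (suc k)) + suc k * (0 C suc k)
      ≡⟨ cong₂ (λ u v → suc (suc k) * u + suc k * v) (k>n⇒nCk≡0 {0} {suc (suc k)} (s≤s z≤n)) (k>n⇒nCk≡0 {0} {suc k} (s≤s z≤n)) ⟩
    suc (suc k) * 0 + suc k * 0 ≡⟨ cong₂ _+_ (*-zeroʳ (suc (suc k))) (*-zeroʳ (suc k)) ⟩
    0                           ∎
  where open ≡-Reasoning
absorption (suc m) zero = begin
    1 * (suc m C 1) + 0 ≡⟨ cong (λ u → 1 * u + 0) (nC1≡n (suc m)) ⟩
    1 * suc m + 0       ≡⟨ solve 1 (λ x → con 1 :* x :+ con 0 := x :* con 1) refl (suc m) ⟩
    suc m * 1           ∎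
  where open ≡-Reasoning
absorption (suc m) (suc j) = begin
    suc (suc j) * (suc m C suc (suc j)) + suc j * (suc m C suc j)
      ≡⟨ cong₂ (λ u v → suc (suc j) * u + suc j * v) (pascal m (suc j)) (pascal m j) ⟩
    suc (suc j) * (B + C′) + suc j * (A + B)
      ≡⟨ solve 4 (λ j A B C′ → (con 2 :+ j) :* (B :+ C′) :+ (con 1 :+ j) :* (A :+ B)
                 := ((con 2 :+ j) :* C′ :+ (con 1 :+ j) :* B) :+ ((con 1 :+ j) :* B :+ j :* A) :+ B :+ A) refl j A B C′ ⟩
    (suc (suc j) * C′ + suc j * B) + (suc j * B + j * A) + B + A
      ≡⟨ cong (λ u → u + B + A) (cong₂ _+_ (absorption m (suc j)) (absorption m j)) ⟩
    m * B + m * A + B + A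
      ≡⟨ solve 3 (λ m A B → m :* B :+ m :* A :+ B :+ A := (con 1 :+ m) :* (A :+ B)) refl m A B ⟩
    suc m * (A + B)
      ≡⟨ cong (suc m *_) (sym (pascal m j)) ⟩
    suc m * (suc m C suc j) ∎
  where
  open ≡-Reasoning
  A = m C j
  B = m C suc j
  C′ = m C suc (suc j)

length-ballot-Catalan : ∀ n → length (ballot n n) ≡ Catalan n
length-ballot-Catalan n = begin
    L                     ≡⟨ sym (m*n/n≡m L (suc n)) ⟩
    (L * suc n) / suc n   ≡⟨ cong (_/ suc n) L*[n+1]≡Y ⟩
    ((n + n) C n) / suc n ≡⟨ cong (λ q → (q C n) / suc n) (cong (n +_) (sym (+-identityʳ n))) ⟩
    Catalan n             ∎
  where
  open ≡-Reasoning
  L = length (ballot n n)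
  X = (n + n) C suc n
  Y = (n + n) C n
  [n+1]X≡nY : suc n * X ≡ n * Y
  [n+1]X≡nY = +-cancelʳ-≡ (n * Y) (suc n * X) (n * Y) (trans (absorption (n + n) n) (*-distribʳ-+ Y n n))
  L*[n+1]≡Y : L * suc n ≡ Y
  L*[n+1]≡Y = +-cancelʳ-≡ (n * Y) (L * suc n) Y (begin
      L * suc n + n * Y     ≡⟨ cong (L * suc n +_) (sym [n+1]X≡nY) ⟩
      L * suc n + suc n * X ≡⟨ solve 3 (λ L X n → L :* (con 1 :+ n) :+ (con 1 :+ n) :* X := (L :+ X) :* (con 1 :+ n)) refl L X n ⟩
      (L + X) * suc n       ≡⟨ cong (_* suc n) (length-ballot n n ≤-refl) ⟩
      Y * suc n             ≡⟨ solve 2 (λ Y n → Y :* (con 1 :+ n) := Y :+ n :* Y) refl Y n ⟩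
      Y + n * Y             ∎)

-- The poset EN_{s,t}

blk-res : ∀ t' q r → r < suc t' → blk t' (suc (r + q * suc t')) ≡ q × res t' (suc (r + q * suc t')) ≡ r
blk-res t' q r r<n = blk≡ , res≡
  where
  open ≡-Reasoning
  n = suc t'
  blk≡ : (r + q * n) / n ≡ q
  blk≡ = begin
    (r + q * n) / n     ≡⟨ +-distrib-/-∣ʳ r (n∣m*n q) ⟩
    r / n + q * n / n   ≡⟨ cong₂ _+_ (m<n⇒m/n≡0 r<n) (m*n/n≡m q n) ⟩
    q                   ∎
  res≡ : (r + q * n) % n ≡ r
  res≡ = trans ([m+kn]%n≡m%n r q n) (m<n⇒m%n≡m r<n)

∈-block : ∀ t' q {m x} → m ≡ q * suc t' → x ∈ range (suc m) (suc t') →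
  blk t' x ≡ q × res t' x ≡ x ∸ suc m
∈-block t' q {m} {x} m≡ x∈ with ∈-range⁻ (suc m) (suc t') x∈
∈-block t' q {m} {suc y} refl x∈ | s≤s m≤y , s≤s y<m+n =
  subst (λ z → blk t' (suc z) ≡ q × res t' (suc z) ≡ y ∸ m) (m∸n+n≡m m≤y)
        (blk-res t' q (y ∸ m) (m<n+o⇒m∸n<o y m y<m+n))

m∸n≤o⇒m≤n+o : ∀ m n {o} → m ∸ n ≤ o → m ≤ n + o
m∸n≤o⇒m≤n+o m n m∸n≤o = ≤-trans (m≤n+m∸n m n) (+-monoʳ-≤ n m∸n≤o)

⪯-block⇔≤ : ∀ t' q {m x y} → m ≡ q * suc t' → x ∈ range (suc m) (suc t') → y ∈ range (suc m) (suc t') →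
  x ⟨ t' ⟩⪯ y ⇔ x ≤ y
⪯-block⇔≤ t' q {m} {x} {y} m≡ x∈ y∈ with ∈-block t' q m≡ x∈ | ∈-block t' q m≡ y∈
... | blk-x , res-x | blk-y , res-y = mk⇔
  (λ (_ , res≤) → subst (x ≤_) (m+[n∸m]≡n (proj₁ (∈-range⁻ (suc m) (suc t') y∈)))
                    (m∸n≤o⇒m≤n+o x (suc m) (subst₂ _≤_ res-x res-y res≤)))
  (λ x≤y → ≤-reflexive (trans blk-y (sym blk-x)) , subst₂ _≤_ (sym res-x) (sym res-y) (∸-monoˡ-≤ (suc m) x≤y))

linext-unique : ∀ s t' {π} → IsLinExtEN s t' π → Unique π
linext-unique s t' (π↭ , _) = Unique-resp-↭ (↭⇒↭ₛ (↭-sym π↭)) ([n]-unique (s * suc t'))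

linext-chain⊆ : ∀ s t' {π} i f → IsLinExtEN s t' π → (∀ {x} → x ∈ range i f → x ∈ [ s * suc t' ]) →
  (∀ {x} → x ∈ range i f → suc x ∈ range i f → x ⟨ t' ⟩⪯ suc x) → range i f ⊆ π
linext-chain⊆ s t' i f ext@(π↭ , ordered) ⊆[N] chain =
  range⊆ i f (linext-unique s t' ext) (λ x∈ → ∈-resp-↭ (↭-sym π↭) (⊆[N] x∈))
         (λ x∈ sx∈ → ordered _ _ (⊆[N] x∈) (⊆[N] sx∈) (chain x∈ sx∈) (<⇒≢ (n<1+n _)))

module OneBlock (t' : ℕ) where

  n : ℕ
  n = suc t'

  [n]≡ : [ 1 * n ] ≡ range 1 n
  [n]≡ = trans ([n]≡range (1 * n)) (cong (range 1) (*-identityˡ n))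

  range-∈EN : InEN321 1 t' (range 1 n)
  range-∈EN = (subst (range 1 n ↭_) (sym [n]≡) Perm.refl , ordered) ,
              subst (λ π → Avoids π (3 ∷ 2 ∷ 1 ∷ [])) (shuffle-falses 1 1 n) (shuffle-avoids-321 1 1 (replicate n false))
    where
    ordered : ∀ a b → a ∈ [ 1 * n ] → b ∈ [ 1 * n ] → a ⟨ t' ⟩⪯ b → a ≢ b → AppearsBefore a b (range 1 n)
    ordered a b a∈ b∈ a⪯b a≢b =
      pair⊆range a∈′ b∈′ (≤∧≢⇒< (Equivalence.to (⪯-block⇔≤ t' 0 refl a∈′ b∈′) a⪯b) a≢b)
      where
      a∈′ = subst (a ∈_) [n]≡ a∈
      b∈′ = subst (b ∈_) [n]≡ b∈

  ∈EN⇒range : ∀ {π} → InEN321 1 t' π → π ≡ range 1 n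
  ∈EN⇒range {π} (ext@(π↭ , _) , _) = ⊆∧↭⇒≡ range⊆π (subst (π ↭_) [n]≡ π↭)
    where
    ⊆[n] : ∀ {x} → x ∈ range 1 n → x ∈ [ 1 * n ]
    ⊆[n] {x} = subst (x ∈_) (sym [n]≡)
    range⊆π : range 1 n ⊆ π
    range⊆π = linext-chain⊆ 1 t' 1 n ext ⊆[n] (λ x∈ sx∈ → Equivalence.from (⪯-block⇔≤ t' 0 refl x∈ sx∈) (n≤1+n _))

  size : HasSize (InEN321 1 t') 1
  size = range 1 n ∷ [] , [] ∷ [] , (λ π → mk⇔ (λ { (here refl) → range-∈EN }) (λ π∈ → here (∈EN⇒range π∈))) , refl

module TwoBlocks (t' : ℕ) where

  n : ℕ
  n = suc t'

  lower upper : List ℕ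
  lower = range 1 n
  upper = range (suc n) n

  [2n]≡ : [ 2 * n ] ≡ lower ++ upper
  [2n]≡ = trans ([n]≡range (2 * n)) (trans (cong (range 1) (cong (n +_) (+-identityʳ n))) (range-++ 1 n n))

  ∈-[2n]⁻ : ∀ {x} → x ∈ [ 2 * n ] → x ∈ lower ⊎ x ∈ upper
  ∈-[2n]⁻ {x} x∈ = ∈-++⁻ lower (subst (x ∈_) [2n]≡ x∈)

  lower⊆[2n] : ∀ {x} → x ∈ lower → x ∈ [ 2 * n ]
  lower⊆[2n] {x} x∈ = subst (x ∈_) (sym [2n]≡) (∈-++⁺ˡ x∈)

  upper⊆[2n] : ∀ {x} → x ∈ upper → x ∈ [ 2 * n ]
  upper⊆[2n] {x} x∈ = subst (x ∈_) (sym [2n]≡) (∈-++⁺ʳ lower x∈)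

  ⪯-lower : ∀ {x y} → x ∈ lower → y ∈ lower → x ⟨ t' ⟩⪯ y ⇔ x ≤ y
  ⪯-lower = ⪯-block⇔≤ t' 0 refl

  ⪯-upper : ∀ {x y} → x ∈ upper → y ∈ upper → x ⟨ t' ⟩⪯ y ⇔ x ≤ y
  ⪯-upper = ⪯-block⇔≤ t' 1 (sym (*-identityˡ n))

  ¬⪯-upward : ∀ {x y} → x ∈ lower → y ∈ upper → ¬ x ⟨ t' ⟩⪯ y
  ¬⪯-upward x∈ y∈ (blk≤ , _) with ∈-block t' 0 refl x∈ | ∈-block t' 1 (sym (*-identityˡ n)) y∈
  ... | blk-x , _ | blk-y , _ = 1+n≰n (subst₂ _≤_ blk-y blk-x blk≤)

  ⪯-downward : ∀ {y x} → y ∈ upper → x ∈ lower → y ⟨ t' ⟩⪯ x ⇔ y ≤ n + x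
  ⪯-downward {y} {x} y∈ x∈ with ∈-block t' 1 (sym (*-identityˡ n)) y∈ | ∈-block t' 0 refl x∈ | ∈-range⁻ 1 n x∈
  ⪯-downward {y} {suc x′} y∈ x∈ | blk-y , res-y | blk-x , res-x | s≤s _ , _ = mk⇔
    (λ (_ , res≤) → subst (y ≤_) (sym (+-suc n x′)) (m∸n≤o⇒m≤n+o y (suc n) (subst₂ _≤_ res-y res-x res≤)))
    (λ y≤ → subst₂ _≤_ (sym blk-x) (sym blk-y) z≤n ,
            subst₂ _≤_ (sym res-y) (sym res-x) (m≤n+o⇒m∸n≤o y (suc n) (subst (y ≤_) (+-suc n x′) y≤)))

  shuffle-∈EN : ∀ {w} → w ∈ ballot n n → InEN321 2 t' (shuffle 1 (suc n) w)
  shuffle-∈EN {w} w∈ = (subst (shuffle 1 (suc n) w ↭_) (sym [2n]≡) (ballot-shuffle-↭ n n 1 (suc n) w∈) , ordered) ,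
                       shuffle-avoids-321 1 (suc n) w
    where
    ordered : ∀ a b → a ∈ [ 2 * n ] → b ∈ [ 2 * n ] → a ⟨ t' ⟩⪯ b → a ≢ b → AppearsBefore a b (shuffle 1 (suc n) w)
    ordered a b a∈ b∈ a⪯b a≢b with ∈-[2n]⁻ a∈ | ∈-[2n]⁻ b∈
    ... | inj₁ a∈ˡ | inj₁ b∈ˡ = ⊆-trans (pair⊆range a∈ˡ b∈ˡ (≤∧≢⇒< (Equivalence.to (⪯-lower a∈ˡ b∈ˡ) a⪯b) a≢b))
                                        (ballot-range⊆shuffleˡ n n 1 (suc n) w∈)
    ... | inj₂ a∈ᵘ | inj₂ b∈ᵘ = ⊆-trans (pair⊆range a∈ᵘ b∈ᵘ (≤∧≢⇒< (Equivalence.to (⪯-upper a∈ᵘ b∈ᵘ) a⪯b) a≢b))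
                                        (ballot-range⊆shuffleʳ n n 1 (suc n) w∈)
    ... | inj₁ a∈ˡ | inj₂ b∈ᵘ = ⊥-elim (¬⪯-upward a∈ˡ b∈ᵘ a⪯b)
    ... | inj₂ a∈ᵘ | inj₁ b∈ˡ = shuffle-cross n n n 1 (suc n) w∈ (sym (+-suc n n)) a∈ᵘ b∈ˡ
                                  (Equivalence.to (⪯-downward a∈ᵘ b∈ˡ) a⪯b)

  ∈EN⇒shuffle : ∀ {π} → InEN321 2 t' π → ∃ λ w → w ∈ ballot n n × π ≡ shuffle 1 (suc n) w
  ∈EN⇒shuffle {π} (ext@(π↭ , ordered) , _) =
    shuffle-complete n n n 1 (suc n) ≤-refl ≤-refl (sym (+-suc n n)) (linext-unique 2 t' ext) (subst (π ↭_) [2n]≡ π↭)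
      (linext-chain⊆ 2 t' 1 n ext lower⊆[2n] (λ x∈ sx∈ → Equivalence.from (⪯-lower x∈ sx∈) (n≤1+n _)))
      (linext-chain⊆ 2 t' (suc n) n ext upper⊆[2n] (λ x∈ sx∈ → Equivalence.from (⪯-upper x∈ sx∈) (n≤1+n _)))
      (λ y∈ x∈ y≤ → ordered _ _ (upper⊆[2n] y∈) (lower⊆[2n] x∈) (Equivalence.from (⪯-downward y∈ x∈) y≤)
                      (>⇒≢ (<-≤-trans (proj₂ (∈-range⁻ 1 n x∈)) (proj₁ (∈-range⁻ (suc n) n y∈)))))

  size : HasSize (InEN321 2 t') (Catalan n)
  size = map (shuffle 1 (suc n)) (ballot n n) , shuffle-ballot-unique n n 1 (suc n) ≤-refl ,
         (λ π → mk⇔ to from) , trans (length-map (shuffle 1 (suc n)) (ballot n n)) (length-ballot-Catalan n)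
    where
    to : ∀ {π} → π ∈ map (shuffle 1 (suc n)) (ballot n n) → InEN321 2 t' π
    to π∈ with ∈-map⁻ (shuffle 1 (suc n)) π∈
    ... | w , w∈ , refl = shuffle-∈EN w∈
    from : ∀ {π} → InEN321 2 t' π → π ∈ map (shuffle 1 (suc n)) (ballot n n)
    from π∈EN with ∈EN⇒shuffle π∈EN
    ... | w , w∈ , refl = ∈-map⁺ (shuffle 1 (suc n)) w∈

module ManyBlocks (s' t' : ℕ) where

  n s : ℕ
  n = suc t'
  s = 3 + s'

  corner : ℕ → ℕ
  corner q = suc (q * n)

  corner-< : ∀ q → corner q < corner (suc q)
  corner-< q = s≤s (m<n+m (q * n) (s≤s z≤n))

  corner-⪯ : ∀ q → corner (suc q) ⟨ t' ⟩⪯ corner q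
  corner-⪯ q with blk-res t' q 0 (s≤s z≤n) | blk-res t' (suc q) 0 (s≤s z≤n)
  ... | blk-q , res-q | blk-q+1 , res-q+1 = subst₂ _≤_ (sym blk-q) (sym blk-q+1) (n≤1+n q) ,
                                            subst₂ _≤_ (sym res-q+1) (sym res-q) z≤n

  corner∈ : ∀ {q} → q < s → corner q ∈ [ s * n ]
  corner∈ {q} q<s = subst (corner q ∈_) (sym ([n]≡range (s * n)))
                          (∈-range⁺ 1 (s * n) (s≤s z≤n) (s≤s (*-monoˡ-< n q<s)))

  ¬∈EN : ∀ {π} → ¬ InEN321 s t' π
  ¬∈EN {π} (ext@(_ , ordered) , avoids) =
    avoids (corner 2 ∷ corner 1 ∷ corner 0 ∷ [] ,
            glue (linext-unique s t' ext) (descends 1 (s≤s (s≤s (s≤s z≤n)))) (descends 0 (s≤s (s≤s z≤n))) ,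
            321-pattern⁺ (corner-< 1) (corner-< 0))
    where
    descends : ∀ q → suc q < s → AppearsBefore (corner (suc q)) (corner q) π
    descends q q+1<s = ordered _ _ (corner∈ q+1<s) (corner∈ (<-trans (n<1+n q) q+1<s)) (corner-⪯ q) (>⇒≢ (corner-< q))

  size : HasSize (InEN321 s t') 0
  size = [] , [] , (λ π → mk⇔ (λ ()) (λ π∈EN → ⊥-elim (¬∈EN π∈EN))) , refl

theorem3p3 : (s t' : ℕ) → 3 ≤ s →
    HasSize (InEN321 1 t') 1 ×
    HasSize (InEN321 2 t') (Catalan (suc t')) ×
    HasSize (InEN321 s t') 0
theorem3p3 (suc (suc (suc s'))) t' (s≤s (s≤s (s≤s _))) = OneBlock.size t' , TwoBlocks.size t' , ManyBlocks.size s' t'
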